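{- Let $Q$ be a set of snapshots and let $A,B$ be actors such that $B$ depends on $A$ in $Q$. Then every finalized subset of $Q$ whose domain contains $B$ also contains $A$ in its domain.
   Context: A refob is a triple $(x,A,B)$ of a token $x$, owner actor $A$ and target actor $B$, written $x: A\to B$. A fact is one of $\mathrm{Created}(x)$, $\mathrm{Released}(x)$, $\mathrm{CreatedUsing}(x,y)$, $\mathrm{Activated}(x)$, $\mathrm{Unreleased}(x)$, $\mathrm{SentCount}(x,n)$, $\mathrm{RecvCount}(x,n)$ ($n\in\mathbb N$). A knowledge set $\Phi$ is a finite set of facts; $\Phi\vdash\varphi$ means $\varphi$ is derivable from $\Phi$ in first-order logic plus the rules: if no $\mathrm{SentCount}(x,n)\in\Phi$ then $\Phi\vdash\mathrm{SentCount}(x,0)$; if no $\mathrm{RecvCount}(x,n)\in\Phi$ then $\Phi\vdash\mathrm{RecvCount}(x,0)$; if $\Phi\vdash\mathrm{Created}(x)$ and $\Phi\not\vdash\mathrm{Released}(x)$ then $\Phi\vdash\mathrm{Unreleased}(x)$; if $\Phi\vdash\mathrm{CreatedUsing}(x,y)$ then $\Phi\vdash\mathrm{Created}(y)$. A set of snapshots $Q$ is a finite partial map from actors to knowledge sets; a subset of $Q$ is a restriction of $Q$ to a subset of $\mathrm{dom}(Q)$. For a refob $x:A\to B$: $Q\vdash\mathrm{Activated}(x)$, $Q\vdash\mathrm{SentCount}(x,n)$, $Q\vdash\mathrm{CreatedUsing}(x,y)$ mean $A\in\mathrm{dom}(Q)$ and $Q(A)$ derives the fact; $Q\vdash\mathrm{Created}(x)$,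 $Q\vdash\mathrm{Released}(x)$, $Q\vdash\mathrm{RecvCount}(x,n)$ mean $B\in\mathrm{dom}(Q)$ and $Q(B)$ derives the fact. $Q\vdash\mathrm{Chain}(x:A\to B)$ iff there are refobs $x_1:A_1\to B,\dots,x_n:A_n\to B$ with $Q\vdash\mathrm{Created}(x_1)$, $Q\not\vdash\mathrm{Released}(x_1)$, for all $i<n$ $Q\vdash\mathrm{CreatedUsing}(x_i,x_{i+1})$ and $Q\not\vdash\mathrm{Released}(x_{i+1})$, and $A_n=A$, $x_n=x$. $Q\vdash\mathrm{Relevant}(x)$ iff for some $n$, $Q\vdash\mathrm{Activated}(x)$, $Q\vdash\mathrm{SentCount}(x,n)$ and $Q\vdash\mathrm{RecvCount}(x,n)$. $Q$ is finalized if for all $B\in\mathrm{dom}(Q)$ and all refobs $x:A\to B$, $Q\vdash\mathrm{Chain}(x)$ implies $A\in\mathrm{dom}(Q)$ and $Q\vdash\mathrm{Relevant}(x)$. $B$ depends on $A$ in $Q$ if $A=B$ or there is a sequence of refobs $x_1:A_1\to A_2,\dots,x_{n-1}:A_{n-1}\to A_n$ ($n\ge2$) with $A_1=A$, $A_n=B$ and $Q\vdash\mathrm{Chain}(x_i)$ for each $i<n$. -}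

module Defs where

open import Data.Nat using (ℕ; zero)
open import Data.List using (List)
open import Data.List.Membership.Propositional using (_∈_; _∉_)
open import Data.Maybe using (Maybe; just; nothing)
open import Data.Product using (Σ; ∃; _×_)
open import Data.Sum using (_⊎_)
open import Relation.Binary.PropositionalEquality using (_≡_)
open import Relation.Nullary using (¬_)

-- A refob  x : A → B  (token x, owner A, target B).
record Refob (Token Actor : Set) : Set where
  constructor refob
  field
    token  : Token
    owner  : Actor
    target : Actor
open Refob public

data Fact (Token Actor : Set) : Set where
  Created Released Activated Unreleased : Refob Token Actor → Fact Token Actor
  CreatedUsing : Refob Token Actor → Refob Token Actor → Fact Token Actor
  SentCount RecvCount : Refob Token Actor → ℕ → Fact Token Actor

KnowledgeSet : Set → Set → Set
KnowledgeSet Token Actor = List (Fact Token Actor)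

module _ {Token Actor : Set} where

  private
    R = Refob Token Actor
    F = Fact Token Actor

  -- Knowledge sets contain only atomic facts, so first-order
  -- derivability of an atom is membership, closed under the four rules.
  -- Released facts are only derivable by membership, hence
  -- Φ ⊬ Released(x)  is  Released x ∉ Φ.
  data _⊢_ (Φ : KnowledgeSet Token Actor) : F → Set where
    member       : ∀ {φ} → φ ∈ Φ → Φ ⊢ φ
    sentDefault  : ∀ {x} → (∀ n → SentCount x n ∉ Φ) → Φ ⊢ SentCount x zero
    recvDefault  : ∀ {x} → (∀ n → RecvCount x n ∉ Φ) → Φ ⊢ RecvCount x zero
    unreleased   : ∀ {x} → Φ ⊢ Created x → Released x ∉ Φ → Φ ⊢ Unreleased x
    createdUsing : ∀ {x y} → Φ ⊢ CreatedUsing x y → Φ ⊢ Created y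

-- A set of snapshots: a finite partial map from actors to knowledge sets
-- (finiteness witnessed by a list covering the domain).
record Snapshots (Token Actor : Set) : Set where
  field
    snap      : Actor → Maybe (KnowledgeSet Token Actor)
    support   : List Actor
    supported : ∀ A K → snap A ≡ just K → A ∈ support
open Snapshots public

module _ {Token Actor : Set} where

  private
    R = Refob Token Actor
    F = Fact Token Actor
    S = Snapshots Token Actor

  _∈dom_ : Actor → S → Set
  A ∈dom Q = Σ (KnowledgeSet Token Actor) λ K → snap Q A ≡ just K

  DerivesAt : S → Actor → F → Set
  DerivesAt Q A φ = Σ (KnowledgeSet Token Actor) λ K → (snap Q A ≡ just K) × (K ⊢ φ)

  Q⊢Activated : S → R → Set
  Q⊢Activated Q x = DerivesAt Q (owner x) (Activated x)

  Q⊢SentCount : S → R → ℕ → Set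
  Q⊢SentCount Q x n = DerivesAt Q (owner x) (SentCount x n)

  Q⊢CreatedUsing : S → R → R → Set
  Q⊢CreatedUsing Q x y = DerivesAt Q (owner x) (CreatedUsing x y)

  Q⊢Created : S → R → Set
  Q⊢Created Q x = DerivesAt Q (target x) (Created x)

  Q⊢Released : S → R → Set
  Q⊢Released Q x = DerivesAt Q (target x) (Released x)

  Q⊢RecvCount : S → R → ℕ → Set
  Q⊢RecvCount Q x n = DerivesAt Q (target x) (RecvCount x n)

  -- Q ⊢ Chain(x): x₁,…,xₙ all with the target of x, xₙ = x.
  data Chain (Q : S) : R → Set where
    start : ∀ {x} → Q⊢Created Q x → ¬ Q⊢Released Q x → Chain Q x
    step  : ∀ {x y} → Chain Q x → Q⊢CreatedUsing Q x y →
            target y ≡ target x → ¬ Q⊢Released Q y → Chain Q y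

  Relevant : S → R → Set
  Relevant Q x = ∃ λ n → Q⊢Activated Q x × Q⊢SentCount Q x n × Q⊢RecvCount Q x n

  Finalized : S → Set
  Finalized Q = ∀ (x : R) → target x ∈dom Q → Chain Q x →
                (owner x ∈dom Q) × Relevant Q x

  -- Q' is a subset of Q: the restriction of Q to a subset of dom(Q).
  _⊆S_ : S → S → Set
  Q' ⊆S Q = ∀ A → (snap Q' A ≡ nothing) ⊎ (snap Q' A ≡ snap Q A)

  -- Reaches Q A B : a sequence of refobs A = A₁ → A₂ → … → Aₙ = B
  -- each satisfying Q ⊢ Chain (n = 1 means A = B).
  data Reaches (Q : S) : Actor → Actor → Set where
    here : ∀ {A} → Reaches Q A A
    via  : ∀ {B} (x : R) → Chain Q x → Reaches Q (target x) B → Reaches Q (owner x) B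

  DependsOn : S → Actor → Actor → Set
  DependsOn Q B A = Reaches Q A B

-- A subset Q' of Q agrees with Q on dom(Q'), so at actors of dom(Q') both
-- derive the same facts.  If Q' is finalized, a chain of Q with target in
-- dom(Q') is a chain of Q': inductively the previous refob is a chain of Q',
-- so finalization puts its owner, where its CreatedUsing fact is checked, in
-- dom(Q').  Walking a dependency path back from B, finalization likewise puts
-- the owner of each refob in dom(Q'), ending at A.
module Submission where

open import Defs
open import Data.Product using (_,_; proj₁)
open import Data.Sum using (inj₁; inj₂)
open import Relation.Binary.PropositionalEquality using (_≡_; sym; trans; subst)

module _ {Token Actor : Set} {Q Q' : Snapshots Token Actor} (Q'⊆Q : Q' ⊆S Q) where

  ⊆S-agrees-on-dom : ∀ {A} → A ∈dom Q' → snap Q' A ≡ snap Q A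
  ⊆S-agrees-on-dom {A} (K , Q'A≡K) with Q'⊆Q A
  ... | inj₂ agree = agree
  ... | inj₁ Q'A≡nothing with trans (sym Q'A≡K) Q'A≡nothing
  ...   | ()

  ⊆S-derivesAt⁻ : ∀ {A φ} → A ∈dom Q' → DerivesAt Q A φ → DerivesAt Q' A φ
  ⊆S-derivesAt⁻ A∈Q' (K , QA≡K , K⊢φ) = K , trans (⊆S-agrees-on-dom A∈Q') QA≡K , K⊢φ

  ⊆S-derivesAt : ∀ {A φ} → A ∈dom Q' → DerivesAt Q' A φ → DerivesAt Q A φ
  ⊆S-derivesAt A∈Q' (K , Q'A≡K , K⊢φ) = K , trans (sym (⊆S-agrees-on-dom A∈Q')) Q'A≡K , K⊢φ

  module _ (fin : Finalized Q') where

    finalized-owner∈dom : ∀ {x} → target x ∈dom Q' → Chain Q' x → owner x ∈dom Q'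
    finalized-owner∈dom {x} tx∈Q' chain = proj₁ (fin x tx∈Q' chain)

    finalized-chain⁻ : ∀ {x} → target x ∈dom Q' → Chain Q x → Chain Q' x
    finalized-chain⁻ ty∈Q' (start created not-released) =
      start (⊆S-derivesAt⁻ ty∈Q' created) (λ released → not-released (⊆S-derivesAt ty∈Q' released))
    finalized-chain⁻ ty∈Q' (step {x} chain created-using same-target not-released) =
      step chain′ (⊆S-derivesAt⁻ (finalized-owner∈dom tx∈Q' chain′) created-using) same-target
           (λ released → not-released (⊆S-derivesAt ty∈Q' released))
      where
        tx∈Q' : target x ∈dom Q'
        tx∈Q' = subst (_∈dom Q') same-target ty∈Q'

        chain′ : Chain Q' x
        chain′ = finalized-chain⁻ tx∈Q' chain

    finalized-reaches-∈dom : ∀ {A B} → Reaches Q A B → B ∈dom Q' → A ∈dom Q'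
    finalized-reaches-∈dom here B∈Q' = B∈Q'
    finalized-reaches-∈dom (via x chain path) B∈Q' =
      finalized-owner∈dom tx∈Q' (finalized-chain⁻ tx∈Q' chain)
      where
        tx∈Q' : target x ∈dom Q'
        tx∈Q' = finalized-reaches-∈dom path B∈Q'

lemma7p4 : {Token Actor : Set} (Q : Snapshots Token Actor) (A B : Actor) →
    DependsOn Q B A →
    (Q' : Snapshots Token Actor) → Q' ⊆S Q → Finalized Q' → B ∈dom Q' → A ∈dom Q'
lemma7p4 Q A B B-depends-on-A Q' Q'⊆Q fin = finalized-reaches-∈dom Q'⊆Q fin B-depends-on-A
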